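{- Let $G$ be an $r$-graph on vertex set $[n]$ with average degree $d>0$, let $\tau,\zeta>0$, let $P_r=E(G)$ and let $P_{r-1},\dots,P_1$ be the final multisets constructed by the container algorithm (described in the context) using the weak threshold functions, in either build or prune mode. Then $$\sum_{u\in U}d_s(u)\le(\mu(U)+r\delta)\tau^{r-s}nd$$ for all $U\subset[n]$ and all $1\le s\le r$.
   Context: An $r$-graph ($r\ge2$) is an $r$-uniform hypergraph; $d(\sigma)$ is the number of edges containing $\sigma$, $d(u)=d(\{u\})$, $d$ the average degree, $\mu(U)=\frac1{nd}\sum_{u\in U}d(u)$. Let $\delta$ be the minimum real with $d(\sigma)\le\delta d\tau^{|\sigma|-1}$ for all $\sigma\subset[n]$, $|\sigma|\ge2$. Weak thresholds: for $1\le s\le r-1$, $\theta_s(\{u\})=\tau^{r-s}d(u)$ and $\theta_s(\sigma)=\delta d\tau^{r-s+|\sigma|-1}$ for $2\le|\sigma|\le s$. Container algorithm: $B=\{v:d(v)<\zeta d\}$; $P_r=E(G)$, initially $P_1,\dots,P_{r-1}$ empty multisets and $\Gamma_1,\dots,\Gamma_{r-1}$ empty; $d_s(\sigma)$ = number of members of $P_s$ (with multiplicity) containing $\sigma$. Prune mode: input $I$, initially $T=\emptyset$, output $T$; build mode: input $T$, initially $C=[n]$, output $C$. For $v=1,\dots,n$: for $s=1,\dots,r-1$ let $F_{v,s}$ be the multiset of $s$-sets $f\subset\{v+1,\dots,n\}$ with $\{v\}\cup f\in P_{s+1}$ (multiplicity inherited) containing no member of $\Gamma_s$. If $v\notin B$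 and either $|F_{v,s}|\ge\zeta\tau^{r-s-1}d(v)$ for some $s$ or $\{v\}\in\Gamma_1$: prune mode adds $v$ to $T$ if $v\in I$; build mode removes $v$ from $C$ if $v\notin T$; and if $v\in T$, for $s=1,\dots,r-1$ in turn add $F_{v,s}$ to $P_s$ and put into $\Gamma_s$ every $\sigma\subset\{v+1,\dots,n\}$, $1\le|\sigma|\le s$, with $d_s(\sigma)\ge\theta_s(\sigma)$.
   Formalization: The parameters τ and ζ are positive rationals instead of positive reals, so δ is taken among the rationals as well. -}

module Defs where

open import Data.Nat as ℕ using (ℕ; zero; suc; _∸_)
open import Data.Integer using (+_)
open import Data.Rational as ℚ using (ℚ; 0ℚ; 1ℚ; _+_; _*_; _/_; _≤ᵇ_; _÷_; ≢-nonZero)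
open import Data.Rational.Properties using (_≟_)
open import Data.Bool as Bool using (Bool; true; false; _∧_; _∨_; not; if_then_else_)
open import Data.Fin using (Fin; toℕ)
open import Data.Fin.Subset using (Subset; ∣_∣; ⁅_⁆; ⊤; _∪_; outside; inside; _-_)
  renaming (⊥ to ∅)
open import Data.Fin.Subset.Properties using (_∈?_; _⊆?_)
open import Data.Vec as Vec using (Vec; []; _∷_; tabulate)
open import Data.Vec.Properties using (≡-dec)
open import Data.List as List using (List; []; _∷_; _++_; filter; length; map; foldl; upTo; allFin; concatMap; filterᵇ)
open import Data.Nat.ListAction using (sum)
open import Data.Bool.ListAction using (any; all)
open import Data.List.Relation.Unary.All using (All)
open import Data.List.Relation.Unary.Unique.Propositional using (Unique)
open import Data.Product using (_×_)
open import Relation.Nullary using (yes; no)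
open import Relation.Nullary.Decidable using (does)
open import Relation.Binary.PropositionalEquality using (_≡_)

toℚ : ℕ → ℚ
toℚ k = (+ k) / 1

_^_ : ℚ → ℕ → ℚ
q ^ zero  = 1ℚ
q ^ suc k = q * (q ^ k)

-- division, totalised by  p / 0 = 0  (only ever used with a nonzero divisor)
divℚ : ℚ → ℚ → ℚ
divℚ p q with q ≟ 0ℚ
... | yes _  = 0ℚ
... | no q≢0 = _÷_ p q {{≢-nonZero q≢0}}

-- Hypergraphs on the vertex set [n] = Fin n (with its natural order).
-- An edge set is a list of subsets of Fin n.

IsRGraph : ∀ {n} → ℕ → List (Subset n) → Set
IsRGraph r E = Unique E × All (λ e → ∣ e ∣ ≡ r) E

count : ∀ {n} → List (Subset n) → Subset n → ℕ
count P σ = length (filter (λ e → σ ⊆? e) P)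

deg : ∀ {n} → List (Subset n) → Subset n → ℕ
deg E σ = count E σ

sumOver : ∀ {n} → Subset n → (Fin n → ℕ) → ℕ
sumOver {n} U f = sum (map f (filter (λ u → u ∈? U) (allFin n)))

-- average degree d = (1/n) Σ_u d(u)   (0 for the empty vertex set)
avgDeg : ∀ {n} → List (Subset n) → ℚ
avgDeg {zero}  E = 0ℚ
avgDeg {suc m} E = (+ sumOver ⊤ (λ u → deg E ⁅ u ⁆)) / suc m

μ : ∀ {n} → List (Subset n) → Subset n → ℚ
μ {n} E U = divℚ (toℚ (sumOver U (λ u → deg E ⁅ u ⁆))) (toℚ n * avgDeg E)

DeltaBound : ∀ {n} → List (Subset n) → (τ δ' : ℚ) → Set
DeltaBound E τ δ' =
  ∀ σ → 2 ℕ.≤ ∣ σ ∣ → toℚ (deg E σ) ℚ.≤ δ' * avgDeg E * (τ ^ (∣ σ ∣ ∸ 1))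

IsMinDelta : ∀ {n} → List (Subset n) → (τ δ : ℚ) → Set
IsMinDelta E τ δ = DeltaBound E τ δ × (∀ δ' → DeltaBound E τ δ' → δ ℚ.≤ δ')

above : ∀ {n} → Fin n → Subset n
above v = tabulate (λ w → does (toℕ v ℕ.<? toℕ w))

subsets : ∀ {n} → Subset n → List (Subset n)
subsets []            = [] ∷ []
subsets (outside ∷ p) = map (outside ∷_) (subsets p)
subsets (inside  ∷ p) = map (outside ∷_) (subsets p) ++ map (inside ∷_) (subsets p)

_==ˢ_ : ∀ {n} → Subset n → Subset n → Bool
σ ==ˢ γ = does (≡-dec Bool._≟_ σ γ)

_≤ᴺ_ : ℕ → ℕ → Bool
a ≤ᴺ b = does (a ℕ.≤? b)

data Mode : Set where
  prune build : Mode

record State (n : ℕ) : Set where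
  constructor st
  field
    P : ℕ → List (Subset n)   -- P s  (multisets, as lists)
    Γ : ℕ → List (Subset n)
    T : Subset n
    C : Subset n

module Algorithm {n : ℕ} (r : ℕ) (E : List (Subset n)) (τ ζ δ : ℚ) where

  d : ℚ
  d = avgDeg E

  -- weak thresholds θ_s(σ), used for 1 ≤ |σ| ≤ s
  θ : ℕ → Subset n → ℚ
  θ s σ = if ∣ σ ∣ ℕ.≡ᵇ 1
            then (τ ^ (r ∸ s)) * toℚ (deg E σ)
            else δ * d * (τ ^ ((r ∸ s) ℕ.+ (∣ σ ∣ ∸ 1)))

  inB : Fin n → Bool
  inB v = not ((ζ * d) ≤ᵇ toℚ (deg E ⁅ v ⁆))

  levels : List ℕ
  levels = map suc (upTo (r ∸ 1))

  inLevels : ℕ → Bool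
  inLevels t = (1 ≤ᴺ t) ∧ (t ≤ᴺ (r ∸ 1))

  F : State n → Fin n → ℕ → List (Subset n)
  F S v s = concatMap pick (State.P S (suc s))
    where
      pick : Subset n → List (Subset n)
      pick e =
        let f = e - v in
        if does (v ∈? e) ∧ does (f ⊆? above v) ∧ (∣ f ∣ ℕ.≡ᵇ s)
             ∧ all (λ γ → not (does (γ ⊆? f))) (State.Γ S s)
          then f ∷ [] else []

  step : Mode → Subset n → State n → Fin n → State n
  step mode X S v =
    if trigger then record { P = P' ; Γ = Γ' ; T = T' ; C = C' } else S
    where
      open State S
      trigger : Bool
      trigger = not (inB v)
        ∧ (any (λ s → (ζ * (τ ^ (r ∸ s ∸ 1)) * toℚ (deg E ⁅ v ⁆)) ≤ᵇ toℚ (length (F S v s))) levels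
           ∨ any (λ γ → γ ==ˢ ⁅ v ⁆) (Γ 1))
      T' : Subset n
      T' = newT mode
        where
          newT : Mode → Subset n
          newT prune = if does (v ∈? X) then T ∪ ⁅ v ⁆ else T
          newT build = T
      C' : Subset n
      C' = newC mode
        where
          newC : Mode → Subset n
          newC prune = C
          newC build = if does (v ∈? T) then C else C - v
      upd : ℕ → Bool
      upd t = does (v ∈? T') ∧ inLevels t
      P' : ℕ → List (Subset n)
      P' t = if upd t then P t ++ F S v t else P t
      Γ' : ℕ → List (Subset n)
      Γ' t = if upd t
               then Γ t ++ filterᵇ (λ σ → (1 ≤ᴺ ∣ σ ∣) ∧ (∣ σ ∣ ≤ᴺ t)
                                       ∧ (θ t σ ≤ᵇ toℚ (count (P' t) σ)))
                                  (subsets (above v))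
               else Γ t

  -- initial state; X is the input (I in prune mode, T in build mode)
  init : Mode → Subset n → State n
  init mode X = record
    { P = λ t → if t ℕ.≡ᵇ r then E else []
    ; Γ = λ _ → []
    ; T = initT mode
    ; C = ⊤ }
    where
      initT : Mode → Subset n
      initT prune = ∅
      initT build = X

  run : Mode → Subset n → State n
  run mode X = foldl (step mode X) (init mode X) (allFin n)

  dFinal : Mode → Subset n → ℕ → Subset n → ℕ
  dFinal mode X s σ = count (State.P (run mode X) s) σ

-- Three facts persist through the run: every member of P_t has exactly t elements; for s < r and
-- 1 ≤ |σ| ≤ s, either σ ∈ Γ_s or d_s(σ) ≤ θ_s(σ); and for s ≤ r and |σ| ≥ 1, d_s(σ) is at most the
-- ceiling θ_s(σ) + (r − s) δ d τ^{r−s+|σ|−1}.  Adding F_{v,s} to P_s leaves d_s(σ) unchanged if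
-- |σ| > s, if σ ∈ Γ_s (F_{v,s} avoids Γ_s) or if v ∈ σ (members of F_{v,s} lie above v).  Otherwise
-- d_s(σ) ≤ θ_s(σ), and it grows by at most d_{s+1}(σ ∪ {v}), whose ceiling at level s + 1 is exactly
-- (r − s) δ d τ^{r−s+|σ|−1}.  Sets reaching their threshold enter Γ_s at once, which keeps the second
-- fact.  For σ = {u} the ceiling is τ^{r−s} d(u) + (r − s) δ d τ^{r−s}; sum over u ∈ U.

module Submission where

open import Defs
open import Data.Nat using (ℕ; _≤_; _∸_)
open import Data.Fin.Subset using (Subset; ⁅_⁆)
open import Data.List using (List)
open import Data.Rational using (ℚ; 0ℚ; _<_; _+_; _*_) renaming (_≤_ to _≤ℚ_)

open import Data.Bool.Base using (Bool; true; false; T; not; _∧_; _∨_; if_then_else_)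
open import Data.Bool.Properties using (T-∧; if-cong)
open import Data.Bool.ListAction using (all; any)
open import Data.Empty using (⊥-elim)
open import Data.Fin.Base using (Fin; zero; suc; toℕ)
open import Data.Fin.Subset using (∣_∣; _∪_; _-_; _⊆_; _∈_; _∉_; inside; outside; ⊤)
open import Data.Fin.Subset.Properties
  using (_∈?_; _⊆?_; drop-∷-⊆; p⊆q⇒∣p∣≤∣q∣; p─q⊆p; ⊆-trans; x∈p∪q⁻; x∈⁅y⁆⇒x≡y; ∣⁅x⁆∣≡1; ∪-identityʳ)
import Data.Integer.Base as ℤ
import Data.Integer.Properties as ℤₚ
open import Data.List.Base using ([]; _∷_; _++_; map; filter; filterᵇ; length; concatMap; foldl; allFin)
import Data.List.Properties as Listₚ
open import Data.List.Membership.Propositional using () renaming (_∈_ to _∈ˡ_)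
open import Data.List.Membership.Propositional.Properties using (∈-map⁺; ∈-++⁺ˡ; ∈-++⁺ʳ; ∈-filter⁺)
open import Data.List.Relation.Unary.All as All using (All; []; _∷_)
import Data.List.Relation.Unary.All.Properties as Allₚ
open import Data.List.Relation.Unary.Any using (here)
import Data.Nat as ℕ
open import Data.Nat.Base using (zero; suc; z≤n; s≤s)
import Data.Nat.Properties as ℕₚ
open import Data.Nat.Divisibility using (∣1⇒≡1)
open import Data.Nat.ListAction using (sum)
open import Data.Product using (_×_; _,_; proj₁; proj₂)
import Data.Rational.Base as ℚ
open import Data.Rational.Base using (1ℚ; mkℚ; *≤*; _≤ᵇ_)
import Data.Rational.Properties as ℚₚ
open import Data.Rational.Solver using (module +-*-Solver)
open import Data.Sum using (_⊎_; inj₁; inj₂)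
import Data.Sum as Sum
open import Data.Unit using (tt)
open import Data.Vec.Base using ([]; _∷_; here; there; lookup)
open import Data.Vec.Properties using ([]=⇒lookup; lookup∘tabulate)
open import Function using (Equivalence; _$_; _∘_; id)
open import Relation.Nullary using (Dec; yes; no; does; ¬_)
open import Relation.Nullary.Decidable using (dec-true; dec-false; T?)
open import Relation.Binary.PropositionalEquality

open +-*-Solver
open Equivalence using (to; from)

does-sound : ∀ {a} {A : Set a} (a? : Dec A) → T (does a?) → A
does-sound (yes a) _ = a

does-complete : ∀ {a} {A : Set a} (a? : Dec A) → A → T (does a?)
does-complete a? a = subst T (sym (dec-true a? a)) tt

not-does-sound : ∀ {a} {A : Set a} (a? : Dec A) → T (not (does a?)) → ¬ A
not-does-sound (no ¬a) _ = ¬a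

if-preserves : ∀ {a p} {A : Set a} (P : A → Set p) b {x y} → P x → P y → P (if b then x else y)
if-preserves P true  px _  = px
if-preserves P false _  py = py

≥2⇒≡ᵇ1≡false : ∀ {j} → 2 ≤ j → (j ℕ.≡ᵇ 1) ≡ false
≥2⇒≡ᵇ1≡false (s≤s (s≤s _)) = refl

≤∸1⇒< : ∀ {t m} → 1 ≤ t → t ≤ m ∸ 1 → t ℕ.< m
≤∸1⇒< {m = suc m} _         t≤m = s≤s t≤m
≤∸1⇒< {m = zero}  (s≤s z≤n) ()

m∸n≡1+[m∸1+n] : ∀ {m n} → n ℕ.< m → m ∸ n ≡ suc (m ∸ suc n)
m∸n≡1+[m∸1+n] {suc m} {zero}  _         = refl
m∸n≡1+[m∸1+n] {suc m} {suc n} (s≤s n<m) = m∸n≡1+[m∸1+n] n<m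

toℚ≡mkℚ : ∀ k → toℚ k ≡ mkℚ (ℤ.+ k) 0 (λ (_ , d∣1) → ∣1⇒≡1 d∣1)
toℚ≡mkℚ k = ℚₚ.normalize-coprime _

toℚ-+ : ∀ a b → toℚ (a ℕ.+ b) ≡ toℚ a + toℚ b
toℚ-+ a b rewrite toℚ≡mkℚ a | toℚ≡mkℚ b =
  ℚₚ./-cong (trans (ℤₚ.pos-+ a b) (sym (cong₂ ℤ._+_ (ℤₚ.*-identityʳ (ℤ.+ a)) (ℤₚ.*-identityʳ (ℤ.+ b))))) refl

toℚ-mono-≤ : ∀ {a b} → a ≤ b → toℚ a ≤ℚ toℚ b
toℚ-mono-≤ {a} {b} a≤b rewrite toℚ≡mkℚ a | toℚ≡mkℚ b =
  *≤* (subst₂ ℤ._≤_ (sym (ℤₚ.*-identityʳ (ℤ.+ a))) (sym (ℤₚ.*-identityʳ (ℤ.+ b))) (ℤ.+≤+ a≤b))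

toℚ-nonNeg : ∀ a → 0ℚ ≤ℚ toℚ a
toℚ-nonNeg a = toℚ-mono-≤ {0} {a} z≤n

+-nonNeg : ∀ {p q} → 0ℚ ≤ℚ p → 0ℚ ≤ℚ q → 0ℚ ≤ℚ p + q
+-nonNeg {p} {q} 0≤p 0≤q = subst (_≤ℚ p + q) (ℚₚ.+-identityˡ 0ℚ) (ℚₚ.+-mono-≤ 0≤p 0≤q)

*-nonNeg : ∀ {p q} → 0ℚ ≤ℚ p → 0ℚ ≤ℚ q → 0ℚ ≤ℚ p * q
*-nonNeg {p} {q} 0≤p 0≤q =
  ℚₚ.nonNegative⁻¹ (p * q) {{ℚₚ.nonNeg*nonNeg⇒nonNeg p {{ℚ.nonNegative 0≤p}} q {{ℚ.nonNegative 0≤q}}}}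

*-pos : ∀ {p q} → 0ℚ < p → 0ℚ < q → 0ℚ < p * q
*-pos {p} {q} 0<p 0<q =
  ℚₚ.positive⁻¹ (p * q) {{ℚₚ.pos*pos⇒pos p {{ℚ.positive 0<p}} q {{ℚ.positive 0<q}}}}

^-nonNeg : ∀ {p} → 0ℚ ≤ℚ p → ∀ k → 0ℚ ≤ℚ p ^ k
^-nonNeg 0≤p zero    = ℚₚ.nonNegative⁻¹ 1ℚ
^-nonNeg 0≤p (suc k) = *-nonNeg 0≤p (^-nonNeg 0≤p k)

^-pos : ∀ {p} → 0ℚ < p → ∀ k → 0ℚ < p ^ k
^-pos 0<p zero    = ℚₚ.positive⁻¹ 1ℚ
^-pos 0<p (suc k) = *-pos 0<p (^-pos 0<p k)

nonNeg-cancelʳ : ∀ {p q} → 0ℚ < q → 0ℚ ≤ℚ p * q → 0ℚ ≤ℚ p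
nonNeg-cancelʳ {p} {q} 0<q 0≤pq =
  ℚₚ.*-cancelʳ-≤-pos q {{ℚ.positive 0<q}} (subst (_≤ℚ p * q) (sym (ℚₚ.*-zeroˡ q)) 0≤pq)

divℚ-*-cancel : ∀ p {q} → q ≢ 0ℚ → divℚ p q * q ≡ p
divℚ-*-cancel p {q} q≢0 with q ℚₚ.≟ 0ℚ
... | yes q≡0 = ⊥-elim (q≢0 q≡0)
... | no  q≢0′ = let instance _ = ℚ.≢-nonZero q≢0′ in begin
  p * ℚ.1/ q * q   ≡⟨ ℚₚ.*-assoc p (ℚ.1/ q) q ⟩
  p * (ℚ.1/ q * q) ≡⟨ cong (p *_) (ℚₚ.*-inverseˡ q) ⟩
  p * 1ℚ           ≡⟨ ℚₚ.*-identityʳ p ⟩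
  p                ∎
  where open ≡-Reasoning

sum-≤-affine : ∀ {A : Set} (f g : A → ℕ) (a c : ℚ) → (∀ x → toℚ (f x) ≤ℚ a * toℚ (g x) + c) →
               ∀ xs → toℚ (sum (map f xs)) ≤ℚ a * toℚ (sum (map g xs)) + toℚ (length xs) * c
sum-≤-affine f g a c f≤ [] = ℚₚ.≤-reflexive (solve 2 (λ a c → con 0ℚ := a :* con 0ℚ :+ con 0ℚ :* c) refl a c)
sum-≤-affine f g a c f≤ (x ∷ xs) = begin
  toℚ (f x ℕ.+ F)
    ≡⟨ toℚ-+ (f x) F ⟩
  toℚ (f x) + toℚ F
    ≤⟨ ℚₚ.+-mono-≤ (f≤ x) (sum-≤-affine f g a c f≤ xs) ⟩
  (a * toℚ (g x) + c) + (a * toℚ G + ℓ * c)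
    ≡⟨ solve 5 (λ a c y G ℓ → (a :* y :+ c) :+ (a :* G :+ ℓ :* c) := a :* (y :+ G) :+ (con 1ℚ :+ ℓ) :* c)
               refl a c (toℚ (g x)) (toℚ G) ℓ ⟩
  a * (toℚ (g x) + toℚ G) + (1ℚ + ℓ) * c
    ≡⟨ cong₂ (λ y z → a * y + z * c) (toℚ-+ (g x) G) (toℚ-+ 1 (length xs)) ⟨
  a * toℚ (g x ℕ.+ G) + toℚ (suc (length xs)) * c ∎
  where
  open ℚₚ.≤-Reasoning
  F = sum (map f xs)
  G = sum (map g xs)
  ℓ = toℚ (length xs)

∉-above-self : ∀ {n} (v : Fin n) → v ∉ above v
∉-above-self v v∈above = (λ ()) $ begin
    inside                   ≡⟨ []=⇒lookup v∈above ⟨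
    lookup (above v) v       ≡⟨ lookup∘tabulate _ v ⟩
    does (toℕ v ℕ.<? toℕ v)  ≡⟨ dec-false (toℕ v ℕ.<? toℕ v) (ℕₚ.<-irrefl refl) ⟩
    outside                  ∎
  where open ≡-Reasoning

∣p∪⁅x⁆∣≡1+∣p∣ : ∀ {n} (p : Subset n) (x : Fin n) → x ∉ p → ∣ p ∪ ⁅ x ⁆ ∣ ≡ suc ∣ p ∣
∣p∪⁅x⁆∣≡1+∣p∣ (outside ∷ p) zero    _   = cong (suc ∘ ∣_∣) (∪-identityʳ p)
∣p∪⁅x⁆∣≡1+∣p∣ (inside  ∷ p) zero    x∉p = ⊥-elim (x∉p here)
∣p∪⁅x⁆∣≡1+∣p∣ (outside ∷ p) (suc x) x∉p = ∣p∪⁅x⁆∣≡1+∣p∣ p x (x∉p ∘ there)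
∣p∪⁅x⁆∣≡1+∣p∣ (inside  ∷ p) (suc x) x∉p = cong suc (∣p∪⁅x⁆∣≡1+∣p∣ p x (x∉p ∘ there))

p⊆q-x⇒p∪⁅x⁆⊆q : ∀ {n} {p q : Subset n} {x : Fin n} → x ∈ q → p ⊆ q - x → p ∪ ⁅ x ⁆ ⊆ q
p⊆q-x⇒p∪⁅x⁆⊆q {p = p} {q} {x} x∈q p⊆q-x y∈p∪x with x∈p∪q⁻ p ⁅ x ⁆ y∈p∪x
... | inj₁ y∈p = p─q⊆p q ⁅ x ⁆ (p⊆q-x y∈p)
... | inj₂ y∈x = subst (_∈ q) (sym (x∈⁅y⁆⇒x≡y x y∈x)) x∈q

∈-subsets : ∀ {n} {σ p : Subset n} → σ ⊆ p → σ ∈ˡ subsets p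
∈-subsets {σ = []}          {[]}          _   = here refl
∈-subsets {σ = outside ∷ σ} {outside ∷ p} σ⊆p = ∈-map⁺ (outside ∷_) (∈-subsets (drop-∷-⊆ σ⊆p))
∈-subsets {σ = inside  ∷ σ} {outside ∷ p} σ⊆p with () ← σ⊆p here
∈-subsets {σ = outside ∷ σ} {inside  ∷ p} σ⊆p = ∈-++⁺ˡ (∈-map⁺ (outside ∷_) (∈-subsets (drop-∷-⊆ σ⊆p)))
∈-subsets {σ = inside  ∷ σ} {inside  ∷ p} σ⊆p =
  ∈-++⁺ʳ (map (outside ∷_) (subsets p)) (∈-map⁺ (inside ∷_) (∈-subsets (drop-∷-⊆ σ⊆p)))

module _ {n : ℕ} where

  count-++ : ∀ (xs ys : List (Subset n)) σ → count (xs ++ ys) σ ≡ count xs σ ℕ.+ count ys σ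
  count-++ xs ys σ = trans (cong length (Listₚ.filter-++ (σ ⊆?_) xs ys)) (Listₚ.length-++ (filter (σ ⊆?_) xs))

  count-none : ∀ {xs : List (Subset n)} {σ} → All (λ e → ¬ σ ⊆ e) xs → count xs σ ≡ 0
  count-none {σ = σ} none = cong length (Listₚ.filter-none (σ ⊆?_) none)

  count-uniform : ∀ {t} {xs : List (Subset n)} σ → All (λ e → ∣ e ∣ ≡ t) xs → t ℕ.< ∣ σ ∣ → count xs σ ≡ 0
  count-uniform σ sizes t<∣σ∣ = count-none (All.map too-small sizes)
    where
    too-small : ∀ {e} → ∣ e ∣ ≡ _ → ¬ σ ⊆ e
    too-small refl σ⊆e = ℕₚ.<⇒≱ t<∣σ∣ (p⊆q⇒∣p∣≤∣q∣ σ⊆e)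

  count-[-]-≤ : ∀ {f e σ σ′ : Subset n} → (σ ⊆ f → σ′ ⊆ e) → count (f ∷ []) σ ≤ count (e ∷ []) σ′
  count-[-]-≤ {f} {σ = σ} {σ′} imp with σ ⊆? f
  ... | no  _    = z≤n
  ... | yes σ⊆f rewrite Listₚ.filter-accept (σ′ ⊆?_) {xs = []} (imp σ⊆f) = ℕₚ.≤-refl

  module _ (c : Subset n → Bool) (h : Subset n → Subset n) where

    selection : List (Subset n) → List (Subset n)
    selection = concatMap (λ e → if c e then h e ∷ [] else [])

    All-selection : ∀ {ℓ} {Q : Subset n → Set ℓ} → (∀ e → T (c e) → Q (h e)) → ∀ xs → All Q (selection xs)
    All-selection q [] = []
    All-selection {Q = Q} q (e ∷ xs) = Allₚ.++⁺ (head-case (c e) (q e)) (All-selection q xs)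
      where
      head-case : ∀ b → (T b → Q (h e)) → All Q (if b then h e ∷ [] else [])
      head-case true  qe = qe tt ∷ []
      head-case false _  = []

    count-selection-≤ : ∀ σ σ′ → (∀ e → T (c e) → σ ⊆ h e → σ′ ⊆ e) →
                        ∀ xs → count (selection xs) σ ≤ count xs σ′
    count-selection-≤ σ σ′ imp [] = z≤n
    count-selection-≤ σ σ′ imp (e ∷ xs) = begin
      count (selection (e ∷ xs)) σ                 ≡⟨ count-++ picked (selection xs) σ ⟩
      count picked σ ℕ.+ count (selection xs) σ    ≤⟨ ℕₚ.+-mono-≤ (head-case (c e) (imp e)) (count-selection-≤ σ σ′ imp xs) ⟩
      count (e ∷ []) σ′ ℕ.+ count xs σ′            ≡⟨ count-++ (e ∷ []) xs σ′ ⟨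
      count (e ∷ xs) σ′                            ∎
      where
      open ℕₚ.≤-Reasoning
      picked = if c e then h e ∷ [] else []
      head-case : ∀ b → (T b → σ ⊆ h e → σ′ ⊆ e) → count (if b then h e ∷ [] else []) σ ≤ count (e ∷ []) σ′
      head-case true  imp-e = count-[-]-≤ (imp-e tt)
      head-case false _     = z≤n

module ContainerRun {n : ℕ} (r : ℕ) (E : List (Subset n)) (τ ζ δ : ℚ)
  (E-uniform : All (λ e → ∣ e ∣ ≡ r) E) (0≤τ : 0ℚ ≤ℚ τ) (0≤d : 0ℚ ≤ℚ avgDeg E) (0≤δ : 0ℚ ≤ℚ δ)
  (δ-bound : DeltaBound E τ δ) where

  open Algorithm r E τ ζ δ

  -- Copies of the where-bound definitions of F and step, so that step-unfold holds by refl.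

  admissible : State n → Fin n → ℕ → Subset n → Bool
  admissible S v s e = does (v ∈? e) ∧ does ((e - v) ⊆? above v) ∧ (∣ e - v ∣ ℕ.≡ᵇ s)
                         ∧ all (λ γ → not (does (γ ⊆? (e - v)))) (State.Γ S s)

  triggered : State n → Fin n → Bool
  triggered S v = not (inB v)
    ∧ (any (λ s → (ζ * (τ ^ (r ∸ s ∸ 1)) * toℚ (deg E ⁅ v ⁆)) ≤ᵇ toℚ (length (F S v s))) levels
       ∨ any (λ γ → γ ==ˢ ⁅ v ⁆) (State.Γ S 1))

  nextT : Mode → Subset n → State n → Fin n → Subset n
  nextT prune X S v = if does (v ∈? X) then State.T S ∪ ⁅ v ⁆ else State.T S
  nextT build X S v = State.T S

  nextC : Mode → Subset n → State n → Fin n → Subset n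
  nextC prune X S v = State.C S
  nextC build X S v = if does (v ∈? State.T S) then State.C S else State.C S - v

  saturated : List (Subset n) → ℕ → Subset n → Bool
  saturated Ps t σ = (1 ≤ᴺ ∣ σ ∣) ∧ (∣ σ ∣ ≤ᴺ t) ∧ (θ t σ ≤ᵇ toℚ (count Ps σ))

  extendP : Bool → State n → Fin n → ℕ → List (Subset n)
  extendP u S v t = if u then State.P S t ++ F S v t else State.P S t

  extendΓ : Bool → State n → Fin n → ℕ → List (Subset n)
  extendΓ u S v t =
    if u then State.Γ S t ++ filterᵇ (saturated (extendP u S v t) t) (subsets (above v)) else State.Γ S t

  extend : (ℕ → Bool) → State n → Fin n → Subset n → Subset n → State n
  extend u S v T′ C′ = st (λ t → extendP (u t) S v t) (λ t → extendΓ (u t) S v t) T′ C′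

  step-unfold : ∀ mode X S v → step mode X S v ≡
    (if triggered S v
       then extend (λ t → does (v ∈? nextT mode X S v) ∧ inLevels t) S v (nextT mode X S v) (nextC mode X S v)
       else S)
  step-unfold prune X S v = refl
  step-unfold build X S v = refl

  inLevels⇒<r : ∀ {t} → T (inLevels t) → t ℕ.< r
  inLevels⇒<r {t} ok with 1≤t , t≤r∸1 ← to (T-∧ {1 ≤ᴺ t}) ok =
    ≤∸1⇒< (does-sound (1 ℕ.≤? t) 1≤t) (does-sound (t ℕ.≤? r ∸ 1) t≤r∸1)

  record Admissible (S : State n) (v : Fin n) (s : ℕ) (f : Subset n) : Set where
    field
      ⊆above  : f ⊆ above v
      size    : ∣ f ∣ ≡ s
      avoidsΓ : ∀ {γ} → γ ∈ˡ State.Γ S s → ¬ γ ⊆ f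

  admissible-sound : ∀ S v s e → T (admissible S v s e) → v ∈ e × Admissible S v s (e - v)
  admissible-sound S v s e ok
    with v∈e , ok₁      ← to (T-∧ {does (v ∈? e)}) ok
    with ⊆above , ok₂   ← to (T-∧ {does ((e - v) ⊆? above v)}) ok₁
    with size , avoidsΓ ← to (T-∧ {∣ e - v ∣ ℕ.≡ᵇ s}) ok₂
    = does-sound (v ∈? e) v∈e , record
      { ⊆above  = does-sound ((e - v) ⊆? above v) ⊆above
      ; size    = ℕₚ.≡ᵇ⇒≡ _ _ size
      ; avoidsΓ = λ {γ} γ∈Γ → not-does-sound (γ ⊆? (e - v)) (All.lookup (Allₚ.all⁺ _ (State.Γ S s) avoidsΓ) γ∈Γ)
      }

  -- F S v s is definitionally selection (admissible S v s) (_- v) (State.P S (suc s)).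

  F-admissible : ∀ S v s → All (Admissible S v s) (F S v s)
  F-admissible S v s =
    All-selection (admissible S v s) (_- v) (λ e ok → proj₂ (admissible-sound S v s e ok)) (State.P S (suc s))

  count-F-≤ : ∀ S v s σ → count (F S v s) σ ≤ count (State.P S (suc s)) (σ ∪ ⁅ v ⁆)
  count-F-≤ S v s σ = count-selection-≤ (admissible S v s) (_- v) σ (σ ∪ ⁅ v ⁆)
    (λ e ok → p⊆q-x⇒p∪⁅x⁆⊆q (proj₁ (admissible-sound S v s e ok))) (State.P S (suc s))

  count-F-≡0 : ∀ S v s σ → (∀ {f} → Admissible S v s f → ¬ σ ⊆ f) → count (F S v s) σ ≡ 0
  count-F-≡0 S v s σ excluded = count-none (All.map excluded (F-admissible S v s))

  -- θ s σ for |σ| = j ≥ 2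
  κ : ℕ → ℕ → ℚ
  κ s j = δ * d * τ ^ ((r ∸ s) ℕ.+ (j ∸ 1))

  ceiling : ℕ → Subset n → ℚ
  ceiling s σ = θ s σ + toℚ (r ∸ s) * κ s ∣ σ ∣

  θ-singleton : ∀ s σ → ∣ σ ∣ ≡ 1 → θ s σ ≡ τ ^ (r ∸ s) * toℚ (deg E σ)
  θ-singleton s σ ∣σ∣≡1 = if-cong (cong (ℕ._≡ᵇ 1) ∣σ∣≡1)

  θ-≥2 : ∀ s σ → 2 ≤ ∣ σ ∣ → θ s σ ≡ κ s ∣ σ ∣
  θ-≥2 s σ 2≤∣σ∣ = if-cong (≥2⇒≡ᵇ1≡false 2≤∣σ∣)

  0≤δdτ^ : ∀ k → 0ℚ ≤ℚ δ * d * τ ^ k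
  0≤δdτ^ k = *-nonNeg (*-nonNeg 0≤δ 0≤d) (^-nonNeg 0≤τ k)

  0≤κ : ∀ s j → 0ℚ ≤ℚ κ s j
  0≤κ s j = 0≤δdτ^ ((r ∸ s) ℕ.+ (j ∸ 1))

  0≤θ : ∀ s σ → 0ℚ ≤ℚ θ s σ
  0≤θ s σ = if-preserves (0ℚ ≤ℚ_) (∣ σ ∣ ℕ.≡ᵇ 1) (*-nonNeg (^-nonNeg 0≤τ (r ∸ s)) (toℚ-nonNeg (deg E σ))) (0≤κ s ∣ σ ∣)

  0≤ceiling : ∀ s σ → 0ℚ ≤ℚ ceiling s σ
  0≤ceiling s σ = +-nonNeg (0≤θ s σ) (*-nonNeg (toℚ-nonNeg (r ∸ s)) (0≤κ s ∣ σ ∣))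

  κ-suc : ∀ {s j} → s ℕ.< r → 1 ≤ j → κ (suc s) (suc j) ≡ κ s j
  κ-suc {s} {suc j} s<r _ = cong (λ k → δ * d * τ ^ k) (begin
    (r ∸ suc s) ℕ.+ suc j ≡⟨ ℕₚ.+-suc (r ∸ suc s) j ⟩
    suc (r ∸ suc s) ℕ.+ j ≡⟨ cong (ℕ._+ j) (m∸n≡1+[m∸1+n] s<r) ⟨
    (r ∸ s) ℕ.+ j         ∎)
    where open ≡-Reasoning

  ceiling-∪ : ∀ {s σ v} → s ℕ.< r → v ∉ σ → 1 ≤ ∣ σ ∣ → ceiling (suc s) (σ ∪ ⁅ v ⁆) ≡ toℚ (r ∸ s) * κ s ∣ σ ∣
  ceiling-∪ {s} {σ} {v} s<r v∉σ 1≤∣σ∣ = begin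
    θ (suc s) σ′ + m * K′         ≡⟨ cong (_+ m * K′) (θ-≥2 (suc s) σ′ 2≤∣σ′∣) ⟩
    K′ + m * K′                   ≡⟨ cong (λ x → x + m * x) (trans (cong (κ (suc s)) ∣σ′∣≡) (κ-suc s<r 1≤∣σ∣)) ⟩
    K + m * K                     ≡⟨ solve 2 (λ K m → K :+ m :* K := (con 1ℚ :+ m) :* K) refl K m ⟩
    (1ℚ + m) * K                  ≡⟨ cong (_* K) (toℚ-+ 1 (r ∸ suc s)) ⟨
    toℚ (suc (r ∸ suc s)) * K     ≡⟨ cong (λ k → toℚ k * K) (m∸n≡1+[m∸1+n] s<r) ⟨
    toℚ (r ∸ s) * K               ∎
    where
    open ≡-Reasoning
    σ′ = σ ∪ ⁅ v ⁆
    m = toℚ (r ∸ suc s)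
    K = κ s ∣ σ ∣
    K′ = κ (suc s) ∣ σ′ ∣
    ∣σ′∣≡ : ∣ σ′ ∣ ≡ suc ∣ σ ∣
    ∣σ′∣≡ = ∣p∪⁅x⁆∣≡1+∣p∣ σ v v∉σ
    2≤∣σ′∣ : 2 ≤ ∣ σ′ ∣
    2≤∣σ′∣ = subst (2 ≤_) (sym ∣σ′∣≡) (s≤s 1≤∣σ∣)

  ceiling-r : ∀ σ → ceiling r σ ≡ θ r σ
  ceiling-r σ = begin
    θ r σ + toℚ (r ∸ r) * κ r ∣ σ ∣ ≡⟨ cong (λ k → θ r σ + toℚ k * κ r ∣ σ ∣) (ℕₚ.n∸n≡0 r) ⟩
    θ r σ + 0ℚ * κ r ∣ σ ∣          ≡⟨ cong (θ r σ +_) (ℚₚ.*-zeroˡ (κ r ∣ σ ∣)) ⟩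
    θ r σ + 0ℚ                      ≡⟨ ℚₚ.+-identityʳ (θ r σ) ⟩
    θ r σ                           ∎
    where open ≡-Reasoning

  deg-≤-ceiling : ∀ σ → 1 ≤ ∣ σ ∣ → toℚ (deg E σ) ≤ℚ ceiling r σ
  deg-≤-ceiling σ 1≤∣σ∣ = by-size (∣ σ ∣ ℕ.≤? 1)
    where
    open ≡-Reasoning
    by-size : Dec (∣ σ ∣ ≤ 1) → toℚ (deg E σ) ≤ℚ ceiling r σ
    by-size (yes ∣σ∣≤1) = ℚₚ.≤-reflexive (sym (begin
      ceiling r σ                           ≡⟨ ceiling-r σ ⟩
      θ r σ                                 ≡⟨ θ-singleton r σ (ℕₚ.≤-antisym ∣σ∣≤1 1≤∣σ∣) ⟩
      τ ^ (r ∸ r) * toℚ (deg E σ)           ≡⟨ cong (λ k → τ ^ k * toℚ (deg E σ)) (ℕₚ.n∸n≡0 r) ⟩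
      1ℚ * toℚ (deg E σ)                    ≡⟨ ℚₚ.*-identityˡ (toℚ (deg E σ)) ⟩
      toℚ (deg E σ)                         ∎))
    by-size (no ∣σ∣≰1) = subst (toℚ (deg E σ) ≤ℚ_) (sym (begin
      ceiling r σ                           ≡⟨ ceiling-r σ ⟩
      θ r σ                                 ≡⟨ θ-≥2 r σ (ℕₚ.≰⇒> ∣σ∣≰1) ⟩
      δ * d * τ ^ ((r ∸ r) ℕ.+ (∣ σ ∣ ∸ 1)) ≡⟨ cong (λ k → δ * d * τ ^ (k ℕ.+ (∣ σ ∣ ∸ 1))) (ℕₚ.n∸n≡0 r) ⟩
      δ * d * τ ^ (∣ σ ∣ ∸ 1)               ∎)) (δ-bound σ (ℕₚ.≰⇒> ∣σ∣≰1))

  record Invariant (S : State n) : Set where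
    field
      uniform     : ∀ t → All (λ e → ∣ e ∣ ≡ t) (State.P S t)
      unsaturated : ∀ s → s ℕ.< r → ∀ σ → 1 ≤ ∣ σ ∣ → ∣ σ ∣ ≤ s →
                    σ ∈ˡ State.Γ S s ⊎ toℚ (count (State.P S s) σ) ≤ℚ θ s σ
      bounded     : ∀ s → s ≤ r → ∀ σ → 1 ≤ ∣ σ ∣ → toℚ (count (State.P S s) σ) ≤ℚ ceiling s σ

  module _ {S : State n} (I : Invariant S) (v : Fin n) where
    open Invariant I

    count-extendP : ∀ s σ → count (F S v s) σ ≡ 0 → count (extendP true S v s) σ ≡ count (State.P S s) σ
    count-extendP s σ F∌σ = begin
      count (State.P S s ++ F S v s) σ               ≡⟨ count-++ (State.P S s) (F S v s) σ ⟩
      count (State.P S s) σ ℕ.+ count (F S v s) σ    ≡⟨ cong (count (State.P S s) σ ℕ.+_) F∌σ ⟩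
      count (State.P S s) σ ℕ.+ 0                    ≡⟨ ℕₚ.+-identityʳ _ ⟩
      count (State.P S s) σ                          ∎
      where open ≡-Reasoning

    count-F-bound : ∀ {s} σ → s ℕ.< r → 1 ≤ ∣ σ ∣ → toℚ (count (F S v s) σ) ≤ℚ toℚ (r ∸ s) * κ s ∣ σ ∣
    count-F-bound {s} σ s<r 1≤∣σ∣ = by-v (v ∈? σ)
      where
      open ℚₚ.≤-Reasoning
      by-v : Dec (v ∈ σ) → toℚ (count (F S v s) σ) ≤ℚ toℚ (r ∸ s) * κ s ∣ σ ∣
      by-v (yes v∈σ) = subst (λ k → toℚ k ≤ℚ toℚ (r ∸ s) * κ s ∣ σ ∣)
        (sym (count-F-≡0 S v s σ λ adm σ⊆f → ∉-above-self v (Admissible.⊆above adm (σ⊆f v∈σ))))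
        (*-nonNeg (toℚ-nonNeg (r ∸ s)) (0≤κ s ∣ σ ∣))
      by-v (no v∉σ) = begin
        toℚ (count (F S v s) σ)                          ≤⟨ toℚ-mono-≤ (count-F-≤ S v s σ) ⟩
        toℚ (count (State.P S (suc s)) (σ ∪ ⁅ v ⁆))      ≤⟨ bounded (suc s) s<r (σ ∪ ⁅ v ⁆) 1≤∣σ∪v∣ ⟩
        ceiling (suc s) (σ ∪ ⁅ v ⁆)                      ≡⟨ ceiling-∪ s<r v∉σ 1≤∣σ∣ ⟩
        toℚ (r ∸ s) * κ s ∣ σ ∣                          ∎
        where
        1≤∣σ∪v∣ : 1 ≤ ∣ σ ∪ ⁅ v ⁆ ∣
        1≤∣σ∪v∣ = subst (1 ≤_) (sym (∣p∪⁅x⁆∣≡1+∣p∣ σ v v∉σ)) (s≤s z≤n)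

    ∈-extendΓ : ∀ s σ → σ ⊆ above v → 1 ≤ ∣ σ ∣ → ∣ σ ∣ ≤ s →
                θ s σ ≤ℚ toℚ (count (extendP true S v s) σ) → σ ∈ˡ extendΓ true S v s
    ∈-extendΓ s σ σ⊆above 1≤∣σ∣ ∣σ∣≤s θ≤new = ∈-++⁺ʳ (State.Γ S s)
      (∈-filter⁺ (T? ∘ saturated (extendP true S v s) s) (∈-subsets σ⊆above)
        (from T-∧ (does-complete (1 ℕ.≤? ∣ σ ∣) 1≤∣σ∣ ,
         from T-∧ (does-complete (∣ σ ∣ ℕ.≤? s) ∣σ∣≤s , ℚₚ.≤⇒≤ᵇ θ≤new))))

    extend-uniform : ∀ b t → All (λ e → ∣ e ∣ ≡ t) (extendP b S v t)
    extend-uniform false t = uniform t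
    extend-uniform true  t = Allₚ.++⁺ (uniform t) (All.map Admissible.size (F-admissible S v t))

    extend-unsaturated : ∀ b s → s ℕ.< r → ∀ σ → 1 ≤ ∣ σ ∣ → ∣ σ ∣ ≤ s →
                         σ ∈ˡ extendΓ b S v s ⊎ toℚ (count (extendP b S v s) σ) ≤ℚ θ s σ
    extend-unsaturated false = unsaturated
    extend-unsaturated true s s<r σ 1≤∣σ∣ ∣σ∣≤s = by-position (σ ⊆? above v)
      where
      new = toℚ (count (extendP true S v s) σ)
      by-position : Dec (σ ⊆ above v) → σ ∈ˡ extendΓ true S v s ⊎ new ≤ℚ θ s σ
      by-position (yes σ⊆above) = by-threshold (θ s σ ℚₚ.≤? new)
        where
        by-threshold : Dec (θ s σ ≤ℚ new) → σ ∈ˡ extendΓ true S v s ⊎ new ≤ℚ θ s σ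
        by-threshold (yes θ≤new) = inj₁ (∈-extendΓ s σ σ⊆above 1≤∣σ∣ ∣σ∣≤s θ≤new)
        by-threshold (no  θ≰new) = inj₂ (ℚₚ.<⇒≤ (ℚₚ.≰⇒> θ≰new))
      by-position (no σ⊈above) = Sum.map ∈-++⁺ˡ (subst (λ k → toℚ k ≤ℚ θ s σ) (sym (count-extendP s σ
        (count-F-≡0 S v s σ λ adm σ⊆f → σ⊈above (⊆-trans σ⊆f (Admissible.⊆above adm))))))
        (unsaturated s s<r σ 1≤∣σ∣ ∣σ∣≤s)

    extend-bounded : ∀ b s → (T b → s ℕ.< r) → s ≤ r → ∀ σ → 1 ≤ ∣ σ ∣ →
                     toℚ (count (extendP b S v s) σ) ≤ℚ ceiling s σ
    extend-bounded false s _ = bounded s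
    extend-bounded true s below-r _ σ 1≤∣σ∣ = by-size (∣ σ ∣ ℕ.≤? s)
      where
      open ℚₚ.≤-Reasoning
      s<r = below-r tt
      P = State.P S s
      by-size : Dec (∣ σ ∣ ≤ s) → toℚ (count (P ++ F S v s) σ) ≤ℚ ceiling s σ
      by-size (no ∣σ∣≰s) = subst (λ k → toℚ k ≤ℚ ceiling s σ)
        (sym (count-uniform σ (extend-uniform true s) (ℕₚ.≰⇒> ∣σ∣≰s))) (0≤ceiling s σ)
      by-size (yes ∣σ∣≤s) = Sum.[ in-Γ , below-θ ]′ (unsaturated s s<r σ 1≤∣σ∣ ∣σ∣≤s)
        where
        in-Γ : σ ∈ˡ State.Γ S s → toℚ (count (P ++ F S v s) σ) ≤ℚ ceiling s σ
        in-Γ σ∈Γ = subst (λ k → toℚ k ≤ℚ ceiling s σ)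
          (sym (count-extendP s σ (count-F-≡0 S v s σ λ adm → Admissible.avoidsΓ adm σ∈Γ)))
          (bounded s (ℕₚ.<⇒≤ s<r) σ 1≤∣σ∣)
        below-θ : toℚ (count P σ) ≤ℚ θ s σ → toℚ (count (P ++ F S v s) σ) ≤ℚ ceiling s σ
        below-θ old≤θ = begin
          toℚ (count (P ++ F S v s) σ)                    ≡⟨ cong toℚ (count-++ P (F S v s) σ) ⟩
          toℚ (count P σ ℕ.+ count (F S v s) σ)           ≡⟨ toℚ-+ (count P σ) (count (F S v s) σ) ⟩
          toℚ (count P σ) + toℚ (count (F S v s) σ)       ≤⟨ ℚₚ.+-mono-≤ old≤θ (count-F-bound σ s<r 1≤∣σ∣) ⟩
          θ s σ + toℚ (r ∸ s) * κ s ∣ σ ∣                 ∎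

  extend-preserves : ∀ {S} → Invariant S → ∀ v (u : ℕ → Bool) → (∀ t → T (u t) → t ℕ.< r) →
                     ∀ T′ C′ → Invariant (extend u S v T′ C′)
  extend-preserves I v u below-r _ _ = record
    { uniform     = λ t → extend-uniform I v (u t) t
    ; unsaturated = λ s → extend-unsaturated I v (u s) s
    ; bounded     = λ s → extend-bounded I v (u s) s (below-r s)
    }

  step-preserves : ∀ mode X {S} v → Invariant S → Invariant (step mode X S v)
  step-preserves mode X {S} v I = subst Invariant (sym (step-unfold mode X S v))
    (if-preserves Invariant (triggered S v) (extend-preserves I v _ below-r _ _) I)
    where
    below-r : ∀ t → T (does (v ∈? nextT mode X S v) ∧ inLevels t) → t ℕ.< r
    below-r t ok = inLevels⇒<r (proj₂ (to (T-∧ {does (v ∈? nextT mode X S v)}) ok))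

  initial-elim : ∀ {ℓ} (Q : ℕ → List (Subset n) → Set ℓ) → Q r E → (∀ t → Q t []) →
                 ∀ t → Q t (if t ℕ.≡ᵇ r then E else [])
  initial-elim Q qE q[] t with t ℕ.≡ᵇ r in t≡ᵇr
  ... | false = q[] t
  ... | true with refl ← ℕₚ.≡ᵇ⇒≡ t r (subst T (sym t≡ᵇr) tt) = qE

  init-invariant : ∀ mode X → Invariant (init mode X)
  init-invariant mode X = record
    { uniform     = initial-elim (λ t Ps → All (λ e → ∣ e ∣ ≡ t) Ps) E-uniform (λ _ → [])
    ; unsaturated = initial-elim
        (λ s Ps → s ℕ.< r → ∀ σ → 1 ≤ ∣ σ ∣ → ∣ σ ∣ ≤ s → σ ∈ˡ [] ⊎ toℚ (count Ps σ) ≤ℚ θ s σ)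
        (λ r<r → ⊥-elim (ℕₚ.<-irrefl refl r<r)) (λ s _ σ _ _ → inj₂ (0≤θ s σ))
    ; bounded     = initial-elim
        (λ s Ps → s ≤ r → ∀ σ → 1 ≤ ∣ σ ∣ → toℚ (count Ps σ) ≤ℚ ceiling s σ)
        (λ _ → deg-≤-ceiling) (λ s _ σ _ → 0≤ceiling s σ)
    }

  run-invariant : ∀ mode X → Invariant (run mode X)
  run-invariant mode X = go (allFin n) (init-invariant mode X)
    where
    go : ∀ vs {S} → Invariant S → Invariant (foldl (step mode X) S vs)
    go []       I = I
    go (v ∷ vs) I = go vs (step-preserves mode X v I)

  ceiling-singleton : ∀ s u → ceiling s ⁅ u ⁆ ≡ τ ^ (r ∸ s) * toℚ (deg E ⁅ u ⁆) + toℚ (r ∸ s) * (δ * d * τ ^ (r ∸ s))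
  ceiling-singleton s u = cong₂ _+_ (θ-singleton s ⁅ u ⁆ (∣⁅x⁆∣≡1 u))
    (cong (toℚ (r ∸ s) *_) (trans (cong (κ s) (∣⁅x⁆∣≡1 u)) (cong (λ k → δ * d * τ ^ k) (ℕₚ.+-identityʳ (r ∸ s)))))

  dFinal-singleton-≤ : ∀ mode X {s} → s ≤ r → ∀ u →
    toℚ (dFinal mode X s ⁅ u ⁆) ≤ℚ τ ^ (r ∸ s) * toℚ (deg E ⁅ u ⁆) + toℚ r * (δ * d * τ ^ (r ∸ s))
  dFinal-singleton-≤ mode X {s} s≤r u = begin
    toℚ (dFinal mode X s ⁅ u ⁆)
      ≤⟨ Invariant.bounded (run-invariant mode X) s s≤r ⁅ u ⁆ (ℕₚ.≤-reflexive (sym (∣⁅x⁆∣≡1 u))) ⟩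
    ceiling s ⁅ u ⁆
      ≡⟨ ceiling-singleton s u ⟩
    τ ^ (r ∸ s) * toℚ (deg E ⁅ u ⁆) + toℚ (r ∸ s) * K
      ≤⟨ ℚₚ.+-monoʳ-≤ (τ ^ (r ∸ s) * toℚ (deg E ⁅ u ⁆))
           (ℚₚ.*-monoʳ-≤-nonNeg K {{ℚ.nonNegative (0≤δdτ^ (r ∸ s))}} (toℚ-mono-≤ (ℕₚ.m∸n≤m r s))) ⟩
    τ ^ (r ∸ s) * toℚ (deg E ⁅ u ⁆) + toℚ r * K ∎
    where
    open ℚₚ.≤-Reasoning
    K = δ * d * τ ^ (r ∸ s)

  dFinal-sum-≤ : ∀ mode X U {s} → s ≤ r → 0ℚ < toℚ n * d →
    toℚ (sumOver U (λ u → dFinal mode X s ⁅ u ⁆)) ≤ℚ (μ E U + toℚ r * δ) * (τ ^ (r ∸ s)) * toℚ n * d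
  dFinal-sum-≤ mode X U {s} s≤r 0<nd = begin
    toℚ (sumOver U (λ u → dFinal mode X s ⁅ u ⁆))
      ≤⟨ sum-≤-affine (λ u → dFinal mode X s ⁅ u ⁆) (λ u → deg E ⁅ u ⁆) τᵏ (toℚ r * K)
           (dFinal-singleton-≤ mode X s≤r) vertices ⟩
    τᵏ * toℚ Σd + toℚ (length vertices) * (toℚ r * K)
      ≤⟨ ℚₚ.+-monoʳ-≤ (τᵏ * toℚ Σd) (ℚₚ.*-monoʳ-≤-nonNeg (toℚ r * K) {{ℚ.nonNegative 0≤rK}} (toℚ-mono-≤ |U|≤n)) ⟩
    τᵏ * toℚ Σd + toℚ n * (toℚ r * K)
      ≡⟨ cong (λ x → τᵏ * x + toℚ n * (toℚ r * K)) (divℚ-*-cancel (toℚ Σd) nd≢0) ⟨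
    τᵏ * (μ E U * (toℚ n * d)) + toℚ n * (toℚ r * (δ * d * τᵏ))
      ≡⟨ solve 6 (λ μ τᵏ n d r δ → τᵏ :* (μ :* (n :* d)) :+ n :* (r :* (δ :* d :* τᵏ))
                                 := (μ :+ r :* δ) :* τᵏ :* n :* d) refl (μ E U) τᵏ (toℚ n) d (toℚ r) δ ⟩
    (μ E U + toℚ r * δ) * τᵏ * toℚ n * d ∎
    where
    open ℚₚ.≤-Reasoning
    τᵏ = τ ^ (r ∸ s)
    K = δ * d * τᵏ
    Σd = sumOver U (λ u → deg E ⁅ u ⁆)
    vertices = filter (_∈? U) (allFin n)
    0≤rK : 0ℚ ≤ℚ toℚ r * K
    0≤rK = *-nonNeg (toℚ-nonNeg r) (0≤δdτ^ (r ∸ s))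
    |U|≤n : length vertices ≤ n
    |U|≤n = ℕₚ.≤-trans (Listₚ.length-filter (_∈? U) (allFin n)) (ℕₚ.≤-reflexive (Listₚ.length-tabulate id))
    nd≢0 : toℚ n * d ≢ 0ℚ
    nd≢0 nd≡0 = ℚₚ.<-irrefl (sym nd≡0) 0<nd

sum-map-0 : ∀ {A : Set} (xs : List A) → sum (map (λ _ → 0) xs) ≡ 0
sum-map-0 []       = refl
sum-map-0 (_ ∷ xs) = sum-map-0 xs

avgDeg-[] : ∀ n → avgDeg {n} [] ≡ 0ℚ
avgDeg-[] zero    = refl
avgDeg-[] (suc m) = trans (cong (λ k → ℤ.+ k ℚ./ suc m) (sum-map-0 (filter (_∈? ⊤) (allFin (suc m)))))
                          (ℚₚ.0/n≡0 (suc m))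

0<avgDeg⇒0<n : ∀ {n} {E : List (Subset n)} → 0ℚ < avgDeg E → 0ℚ < toℚ n
0<avgDeg⇒0<n {zero}  0<d = ⊥-elim (ℚₚ.<-irrefl refl 0<d)
0<avgDeg⇒0<n {suc m} _   = ℚₚ.<-≤-trans (ℚₚ.positive⁻¹ 1ℚ) (toℚ-mono-≤ {1} {suc m} (s≤s z≤n))

-- Since d > 0 there is an edge e, and 0 ≤ d(e) ≤ δ d τ^{|e|-1} with d τ^{|e|-1} > 0.
DeltaBound⇒0≤δ : ∀ {n r} {E : List (Subset n)} {τ δ} → 2 ≤ r → All (λ e → ∣ e ∣ ≡ r) E →
                 0ℚ < avgDeg E → 0ℚ < τ → DeltaBound E τ δ → 0ℚ ≤ℚ δ
DeltaBound⇒0≤δ {n} {E = []} _ _ 0<d = ⊥-elim (ℚₚ.<-irrefl (sym (avgDeg-[] n)) 0<d)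
DeltaBound⇒0≤δ {E = e ∷ E} 2≤r (∣e∣≡r ∷ _) 0<d 0<τ δ-bound =
  nonNeg-cancelʳ 0<d (nonNeg-cancelʳ (^-pos 0<τ (∣ e ∣ ∸ 1))
    (ℚₚ.≤-trans (toℚ-nonNeg (deg (e ∷ E) e)) (δ-bound e (subst (2 ≤_) (sym ∣e∣≡r) 2≤r))))

lemma3p5 : (n r : ℕ) (E : List (Subset n)) → 2 ≤ r → IsRGraph r E →
    0ℚ < avgDeg E →
    (τ ζ : ℚ) → 0ℚ < τ → 0ℚ < ζ →
    (δ : ℚ) → IsMinDelta E τ δ →
    (mode : Mode) (X : Subset n) (U : Subset n) (s : ℕ) → 1 ≤ s → s ≤ r →
    toℚ (sumOver U (λ u → Algorithm.dFinal r E τ ζ δ mode X s ⁅ u ⁆))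
      ≤ℚ (μ E U + toℚ r * δ) * (τ ^ (r ∸ s)) * toℚ n * avgDeg E
lemma3p5 n r E 2≤r (_ , E-uniform) 0<d τ ζ 0<τ _ δ (δ-bound , _) mode X U s _ s≤r =
  ContainerRun.dFinal-sum-≤ r E τ ζ δ E-uniform (ℚₚ.<⇒≤ 0<τ) (ℚₚ.<⇒≤ 0<d)
    (DeltaBound⇒0≤δ 2≤r E-uniform 0<d 0<τ δ-bound) δ-bound mode X U s≤r
    (*-pos (0<avgDeg⇒0<n {E = E} 0<d) 0<d)
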